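{- In unweighted Budgeted Allocation, for any disjoint sets of items $A$ and $S$, there exists an optimal allocation of $S\cup A$ in which the contribution (value) of the items of $S$ is exactly $Opt(S)$.
   Context: Unweighted Budgeted Allocation: agents $j$ with capacities $c_j$ and items, each item adjacent to some agents, all edge weights equal (say $1$); a feasible allocation assigns each item to at most one adjacent agent so that agent $j$ receives total weight at most $c_j$; its value is the total weight assigned. $Opt(X)$ is the maximum value of a feasible allocation of the item set $X$. -}

module Defs where

open import Data.Nat using (ℕ; zero; suc; _+_; _≤_)
open import Data.Bool using (Bool; true; false; T; _∧_)
open import Data.Vec using (lookup)
open import Data.Fin using (Fin; zero; suc; _≟_)
open import Data.Fin.Subset using (Subset; _∈_; _∉_)
open import Data.Maybe using (Maybe; just; nothing)
open import Data.Product using (_×_; Σ; ∃; _,_)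
open import Relation.Nullary.Decidable using (⌊_⌋)
open import Relation.Binary.PropositionalEquality using (_≡_)

bit : Bool → ℕ
bit true  = 1
bit false = 0

count : ∀ {n} → (Fin n → Bool) → ℕ
count {zero}  p = 0
count {suc n} p = bit (p zero) + count (λ i → p (suc i))

-- An instance of unweighted Budgeted Allocation:
-- m agents (Fin m), n items (Fin n), capacities c j, and a bipartite
-- adjacency relation adj i j (item i adjacent to agent j).  All edge
-- weights equal 1.
record Instance (m n : ℕ) : Set where
  field
    cap : Fin m → ℕ
    adj : Fin n → Fin m → Bool

-- An allocation assigns each item to at most one agent (nothing = unassigned).
Allocation : ℕ → ℕ → Set
Allocation m n = Fin n → Maybe (Fin m)

assignedTo : ∀ {m} → Maybe (Fin m) → Fin m → Bool
assignedTo nothing  j = false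
assignedTo (just k) j = ⌊ k ≟ j ⌋

isAssigned : ∀ {m} → Maybe (Fin m) → Bool
isAssigned nothing  = false
isAssigned (just _) = true

load : ∀ {m n} → Allocation m n → Fin m → ℕ
load a j = count (λ i → assignedTo (a i) j)

contrib : ∀ {m n} → Subset n → Allocation m n → ℕ
contrib Y a = count (λ i → lookup Y i ∧ isAssigned (a i))

value : ∀ {m n} → Allocation m n → ℕ
value a = count (λ i → isAssigned (a i))

Feasible : ∀ {m n} → Instance m n → Subset n → Allocation m n → Set
Feasible {m} {n} I X a =
  ((i : Fin n) (j : Fin m) → a i ≡ just j → (i ∈ X) × T (Instance.adj I i j))
  × ((j : Fin m) → load a j ≤ Instance.cap I j)

Optimal : ∀ {m n} → Instance m n → Subset n → Allocation m n → Set
Optimal {m} {n} I X a =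
  Feasible I X a × ((b : Allocation m n) → Feasible I X b → value b ≤ value a)

-- Feasible allocations have an augmentation property: if value a < value c,
-- some agent j is less loaded under a than under c, so an item that c gives to j
-- can be moved to j under a.  This keeps a feasible, unassigns no item and brings
-- a closer to c, so repeating it eventually increases the value.  Hence every
-- feasible allocation lies below an optimal one assigning all of its items
-- (optimality being decidable by exhaustive search).  Take b optimal for S and
-- a optimal for S ∪ A above b: the items of S assigned by b stay assigned, so
-- contrib S a ≥ value b, while a restricted to S is feasible for S, so
-- contrib S a ≤ Opt(S) = value b.

module Submission where

open import Defs
open import Data.Nat using (ℕ; zero; suc; _+_; _≤_; _<_; z≤n; s≤s; _≤?_; _<?_)
open import Data.Nat.Properties
  using ( ≤-refl; ≤-trans; ≤-antisym; ≤-<-trans; <-≤-trans; <⇒≱; ≮⇒≥; ≤⇒≯; n<1+n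
        ; +-suc; m≤m+n; m≤n+m; +-mono-≤; +-monoʳ-≤; +-0-commutativeMonoid; module ≤-Reasoning)
open import Algebra.Properties.CommutativeMonoid.Sum +-0-commutativeMonoid
  using (sum; sum-remove; ∑-comm; sum-cong-≗)
open import Data.Bool using (Bool; true; false; T; _∧_; not; if_then_else_)
open import Data.Unit using (tt)
open import Data.Vec using (lookup)
open import Data.Vec.Functional using (removeAt; updateAt; _∷_)
open import Data.Vec.Functional.Properties using (updateAt-updates; updateAt-minimal; ∷-cong)
open import Data.Fin using (Fin; zero; suc; _≟_; punchIn)
open import Data.Fin.Properties using (any?; all?; punchInᵢ≢i)
open import Data.Fin.Subset using (Subset; _∈_; _⊆_; _∪_)
open import Data.Fin.Subset.Properties using (_∈?_; p⊆p∪q)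
open import Data.Maybe using (Maybe; just; nothing)
open import Data.Maybe.Properties using (just-injective) renaming (≡-dec to ≡-dec-Maybe)
open import Data.Product using (Σ; ∃; ∃-syntax; _×_; _,_; proj₁; proj₂; map₁)
open import Data.Sum using (_⊎_; inj₁; inj₂)
open import Data.Empty using (⊥; ⊥-elim)
open import Data.Vec.Properties using ([]=⇒lookup; lookup⇒[]=)
open import Function using (_∘_; id)
open import Level using (0ℓ)
open import Relation.Unary using (Pred; Decidable)
open import Relation.Nullary using (Dec; yes; no; contradiction)
open import Relation.Nullary.Decidable using (⌊_⌋; ⌊⌋-map′; _×-dec_; _→-dec_; T?)
open import Relation.Binary.PropositionalEquality
  using (_≡_; _≢_; _≗_; refl; sym; trans; cong; cong₂; subst; subst₂; module ≡-Reasoning)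

count≡sum : ∀ {n} (p : Fin n → Bool) → count p ≡ sum (bit ∘ p)
count≡sum {zero}  p = refl
count≡sum {suc n} p = cong (bit (p zero) +_) (count≡sum (p ∘ suc))

count-cong : ∀ {n} {p q : Fin n → Bool} → p ≗ q → count p ≡ count q
count-cong {zero}  p≗q = refl
count-cong {suc n} p≗q = cong₂ _+_ (cong bit (p≗q zero)) (count-cong (p≗q ∘ suc))

count-false : ∀ n → count {n} (λ _ → false) ≡ 0
count-false zero    = refl
count-false (suc n) = count-false n

bit-mono : ∀ {x y} → (T x → T y) → bit x ≤ bit y
bit-mono {false}        _   = z≤n
bit-mono {true} {true}  _   = ≤-refl
bit-mono {true} {false} x⇒y = ⊥-elim (x⇒y tt)

count-mono : ∀ {n} {p q : Fin n → Bool} → (∀ i → T (p i) → T (q i)) → count p ≤ count q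
count-mono {zero}  p⇒q = z≤n
count-mono {suc n} p⇒q = +-mono-≤ (bit-mono (p⇒q zero)) (count-mono (p⇒q ∘ suc))

bit≤1 : ∀ x → bit x ≤ 1
bit≤1 true  = ≤-refl
bit≤1 false = z≤n

count≤n : ∀ {n} (p : Fin n → Bool) → count p ≤ n
count≤n {zero}  p = z≤n
count≤n {suc n} p = +-mono-≤ (bit≤1 (p zero)) (count≤n (p ∘ suc))

count-removeAt : ∀ {n} (p : Fin (suc n) → Bool) i → count p ≡ bit (p i) + count (removeAt p i)
count-removeAt p i = begin
  count p                           ≡⟨ count≡sum p ⟩
  sum (bit ∘ p)                     ≡⟨ sum-remove {i = i} (bit ∘ p) ⟩
  bit (p i) + sum (bit ∘ removeAt p i) ≡⟨ cong (bit (p i) +_) (count≡sum (removeAt p i)) ⟨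
  bit (p i) + count (removeAt p i)  ∎
  where open ≡-Reasoning

removeAt-count-cong : ∀ {n} {p q : Fin (suc n) → Bool} i →
  (∀ k → k ≢ i → p k ≡ q k) → count (removeAt p i) ≡ count (removeAt q i)
removeAt-count-cong i agree = count-cong (λ k → agree (punchIn i k) (punchInᵢ≢i i k))

count-≤-agreeOff : ∀ {n} {p q : Fin n → Bool} i →
  (∀ k → k ≢ i → p k ≡ q k) → count p ≤ bit (p i) + count q
count-≤-agreeOff {suc n} {p} {q} i agree = begin
  count p                          ≡⟨ count-removeAt p i ⟩
  bit (p i) + count (removeAt p i) ≡⟨ cong (bit (p i) +_) (removeAt-count-cong i agree) ⟩
  bit (p i) + count (removeAt q i) ≤⟨ +-monoʳ-≤ (bit (p i)) (m≤n+m _ (bit (q i))) ⟩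
  bit (p i) + (bit (q i) + count (removeAt q i)) ≡⟨ cong (bit (p i) +_) (count-removeAt q i) ⟨
  bit (p i) + count q              ∎
  where open ≤-Reasoning

count-<-agreeOff : ∀ {n} {p q : Fin n → Bool} i →
  (∀ k → k ≢ i → p k ≡ q k) → p i ≡ false → q i ≡ true → count p < count q
count-<-agreeOff {suc n} {p} {q} i agree pᵢ≡false qᵢ≡true = begin-strict
  count p                          ≡⟨ count-removeAt p i ⟩
  bit (p i) + count (removeAt p i) ≡⟨ cong₂ _+_ (cong bit pᵢ≡false) (removeAt-count-cong i agree) ⟩
  count (removeAt q i)             <⟨ n<1+n _ ⟩
  bit true + count (removeAt q i)  ≡⟨ cong (λ b → bit b + count (removeAt q i)) qᵢ≡true ⟨
  bit (q i) + count (removeAt q i) ≡⟨ count-removeAt q i ⟨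
  count q                          ∎
  where open ≤-Reasoning

sum-mono-≤ : ∀ {n} {f g : Fin n → ℕ} → (∀ i → f i ≤ g i) → sum f ≤ sum g
sum-mono-≤ {zero}  f≤g = z≤n
sum-mono-≤ {suc n} f≤g = +-mono-≤ (f≤g zero) (sum-mono-≤ (f≤g ∘ suc))

sum-<⇒∃< : ∀ {n} {f g : Fin n → ℕ} → sum f < sum g → ∃[ i ] f i < g i
sum-<⇒∃< {f = f} {g} ∑f<∑g with any? (λ i → f i <? g i)
... | yes found = found
... | no  none  = contradiction ∑f<∑g (≤⇒≯ (sum-mono-≤ λ i → ≮⇒≥ (λ lt → none (i , lt))))

count-<⇒∃ : ∀ {n} {p q : Fin n → Bool} → count p < count q → ∃[ i ] p i ≡ false × q i ≡ true
count-<⇒∃ {p = p} {q} cp<cq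
  with i , bitp<bitq ← sum-<⇒∃< (subst₂ _<_ (count≡sum p) (count≡sum q) cp<cq)
  = i , bits (p i) (q i) bitp<bitq
  where
  bits : ∀ x y → bit x < bit y → x ≡ false × y ≡ true
  bits false true  _ = refl , refl
  bits true  true  (s≤s ())
  bits _     false ()

count-≟ : ∀ {m} (k : Fin m) → count (λ j → ⌊ k ≟ j ⌋) ≡ 1
count-≟ {suc m} zero    = cong suc (count-false m)
count-≟ {suc m} (suc k) = trans (count-cong (λ j → ⌊⌋-map′ _ _ (k ≟ j))) (count-≟ k)

count-assignedTo : ∀ {m} (x : Maybe (Fin m)) → count (assignedTo x) ≡ bit (isAssigned x)
count-assignedTo {m} nothing = count-false m
count-assignedTo (just k)    = count-≟ k

assignedTo-≢ : ∀ {m} {j l : Fin m} → j ≢ l → assignedTo (just j) l ≡ false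
assignedTo-≢ {j = j} {l} j≢l with j ≟ l
... | yes j≡l = contradiction j≡l j≢l
... | no  _   = refl

assignedTo-true : ∀ {m} {x : Maybe (Fin m)} {j} → assignedTo x j ≡ true → x ≡ just j
assignedTo-true {x = just k} {j} e with k ≟ j
... | yes refl = refl

value≡∑load : ∀ {m n} (a : Allocation m n) → value a ≡ sum (load a)
value≡∑load {m} {n} a = begin
  value a                                           ≡⟨ count≡sum (isAssigned ∘ a) ⟩
  sum (λ i → bit (isAssigned (a i)))                ≡⟨ sum-cong-≗ {n} (λ i → trans (sym (count-assignedTo (a i))) (count≡sum (assignedTo (a i)))) ⟩
  sum (λ i → sum (λ j → bit (assignedTo (a i) j)))  ≡⟨ ∑-comm (λ i j → bit (assignedTo (a i) j)) ⟩
  sum (λ j → sum (λ i → bit (assignedTo (a i) j)))  ≡⟨ sum-cong-≗ {m} (λ j → count≡sum (λ i → assignedTo (a i) j)) ⟨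
  sum (load a)                                      ∎
  where open ≡-Reasoning

_⊑_ : ∀ {m n} → Allocation m n → Allocation m n → Set
a ⊑ a′ = ∀ i → T (isAssigned (a i)) → T (isAssigned (a′ i))

⊑-refl : ∀ {m n} {a : Allocation m n} → a ⊑ a
⊑-refl _ = id

⊑-trans : ∀ {m n} {a a′ a″ : Allocation m n} → a ⊑ a′ → a′ ⊑ a″ → a ⊑ a″
⊑-trans a⊑a′ a′⊑a″ i = a′⊑a″ i ∘ a⊑a′ i

value-mono : ∀ {m n} {a a′ : Allocation m n} → a ⊑ a′ → value a ≤ value a′
value-mono = count-mono

reassign : ∀ {m n} → Allocation m n → Fin n → Fin m → Allocation m n
reassign a i j = updateAt a i (λ _ → just j)

module _ {m n} (a : Allocation m n) (i : Fin n) (j : Fin m) where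

  reassign-at : reassign a i j i ≡ just j
  reassign-at = updateAt-updates i a

  reassign-off : ∀ {k} → k ≢ i → reassign a i j k ≡ a k
  reassign-off {k} k≢i = updateAt-minimal k i a k≢i

  reassign-just : ∀ {k l} → reassign a i j k ≡ just l → (k ≡ i × j ≡ l) ⊎ a k ≡ just l
  reassign-just {k} e with k ≟ i
  ... | yes refl = inj₁ (refl , just-injective (trans (sym reassign-at) e))
  ... | no  k≢i  = inj₂ (trans (sym (reassign-off k≢i)) e)

  ⊑-reassign : a ⊑ reassign a i j
  ⊑-reassign k assigned with k ≟ i
  ... | yes refl = subst (T ∘ isAssigned) (sym reassign-at) tt
  ... | no  k≢i  = subst (T ∘ isAssigned) (sym (reassign-off k≢i)) assigned

  load-reassign : ∀ l → load (reassign a i j) l ≤ bit (assignedTo (just j) l) + load a l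
  load-reassign l = subst (λ x → load (reassign a i j) l ≤ bit (assignedTo x l) + load a l) reassign-at
    (count-≤-agreeOff i (λ k k≢i → cong (λ x → assignedTo x l) (reassign-off k≢i)))

reassign-feasible : ∀ {m n} {I : Instance m n} {X} {a : Allocation m n} {i j} →
  Feasible I X a → (i ∈ X) × T (Instance.adj I i j) → load a j < Instance.cap I j →
  Feasible I X (reassign a i j)
reassign-feasible {I = I} {X} {a} {i} {j} (itemsOk , loadsOk) ijOk lⱼ<capⱼ = itemsOk′ , loadsOk′
  where
  itemsOk′ : ∀ k l → reassign a i j k ≡ just l → (k ∈ X) × T (Instance.adj I k l)
  itemsOk′ k l e with reassign-just a i j e
  ... | inj₁ (refl , refl) = ijOk
  ... | inj₂ aₖ≡l          = itemsOk k l aₖ≡l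

  loadsOk′ : ∀ l → load (reassign a i j) l ≤ Instance.cap I l
  loadsOk′ l with j ≟ l
  ... | yes refl = ≤-trans (load-reassign a i j l) (≤-trans (+-mono-≤ (bit≤1 _) ≤-refl) lⱼ<capⱼ)
  ... | no  j≢l  = begin
    load (reassign a i j) l                ≤⟨ load-reassign a i j l ⟩
    bit (assignedTo (just j) l) + load a l ≡⟨ cong (λ b → bit b + load a l) (assignedTo-≢ j≢l) ⟩
    load a l                               ≤⟨ loadsOk l ⟩
    Instance.cap I l                       ∎
    where open ≤-Reasoning

differ : ∀ {m} → Maybe (Fin m) → Maybe (Fin m) → Bool
differ x y = not ⌊ ≡-dec-Maybe _≟_ x y ⌋

differ-≡ : ∀ {m} {x y : Maybe (Fin m)} → x ≡ y → differ x y ≡ false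
differ-≡ {x = x} {y} x≡y with ≡-dec-Maybe _≟_ x y
... | yes _   = refl
... | no  x≢y = contradiction x≡y x≢y

differ-≢ : ∀ {m} {x y : Maybe (Fin m)} → x ≢ y → differ x y ≡ true
differ-≢ {x = x} {y} x≢y with ≡-dec-Maybe _≟_ x y
... | yes x≡y = contradiction x≡y x≢y
... | no  _   = refl

distance : ∀ {m n} → Allocation m n → Allocation m n → ℕ
distance a c = count (λ i → differ (a i) (c i))

distance-reassign : ∀ {m n} {a c : Allocation m n} {i j} → c i ≡ just j → a i ≢ c i →
  distance (reassign a i j) c < distance a c
distance-reassign {a = a} {c} {i} {j} cᵢ≡j aᵢ≢cᵢ = count-<-agreeOff i
  (λ k k≢i → cong (λ x → differ x (c k)) (reassign-off a i j k≢i))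
  (differ-≡ (trans (reassign-at a i j) (sym cᵢ≡j)))
  (differ-≢ aᵢ≢cᵢ)

-- Since value a = ∑ load a, some agent j is less loaded under a than under c.
exchange : ∀ {m n} {a c : Allocation m n} → value a < value c →
  ∃[ i ] ∃[ j ] c i ≡ just j × a i ≢ c i × load a j < load c j
exchange {a = a} {c} va<vc
  with j , lⱼ< ← sum-<⇒∃< (subst₂ _<_ (value≡∑load a) (value≡∑load c) va<vc)
  with i , aᵢj≡false , cᵢj≡true ← count-<⇒∃ lⱼ<
  = i , j , assignedTo-true cᵢj≡true , aᵢ≢cᵢ , lⱼ<
  where
  aᵢ≢cᵢ : a i ≢ c i
  aᵢ≢cᵢ aᵢ≡cᵢ with () ← trans (sym aᵢj≡false) (trans (cong (λ x → assignedTo x j) aᵢ≡cᵢ) cᵢj≡true)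

module _ {m n} {I : Instance m n} {X : Subset n} where

  exchangeStep : ∀ {a c : Allocation m n} → Feasible I X a → Feasible I X c → value a < value c →
    ∃[ a′ ] Feasible I X a′ × a ⊑ a′ × distance a′ c < distance a c
  exchangeStep {a} {c} fa (itemsOk , loadsOk) va<vc
    with i , j , cᵢ≡j , aᵢ≢cᵢ , lⱼ< ← exchange va<vc
    = reassign a i j
    , reassign-feasible fa (itemsOk i j cᵢ≡j) (<-≤-trans lⱼ< (loadsOk j))
    , ⊑-reassign a i j
    , distance-reassign {a = a} {c} cᵢ≡j aᵢ≢cᵢ

  augmentWithin : ∀ k {a c : Allocation m n} → distance a c < k → Feasible I X a → Feasible I X c →
    value a < value c → ∃[ a′ ] Feasible I X a′ × value a < value a′ × a ⊑ a′
  augmentWithin (suc k) {a} {c} (s≤s d≤k) fa fc va<vc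
    with a₁ , fa₁ , a⊑a₁ , d₁<d ← exchangeStep fa fc va<vc
    with value a <? value a₁
  ... | yes va<va₁ = a₁ , fa₁ , va<va₁ , a⊑a₁
  ... | no  va≮va₁
    with a′ , fa′ , va₁<va′ , a₁⊑a′ ← augmentWithin k (<-≤-trans d₁<d d≤k) fa₁ fc (≤-<-trans (≮⇒≥ va≮va₁) va<vc)
    = a′ , fa′ , ≤-<-trans (value-mono a⊑a₁) va₁<va′ , ⊑-trans a⊑a₁ a₁⊑a′

  augment : ∀ {a c : Allocation m n} → Feasible I X a → Feasible I X c → value a < value c →
    ∃[ a′ ] Feasible I X a′ × value a < value a′ × a ⊑ a′
  augment {a} {c} = augmentWithin (suc (distance a c)) ≤-refl

Searchable : Set → Set₁
Searchable B = ∀ {P : Pred B 0ℓ} → Decidable P → Dec (∃ P)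

searchable-Maybe : ∀ {B} → Searchable B → Searchable (Maybe B)
searchable-Maybe search P? with P? nothing | search (P? ∘ just)
... | yes p  | _          = yes (nothing , p)
... | no  _  | yes (x , p) = yes (just x , p)
... | no  ¬p | no  ¬q      = no λ { (nothing , p) → ¬p p ; (just x , p) → ¬q (x , p) }

-- Without function extensionality, the predicate must respect pointwise equality.
search-Fin→ : ∀ {B} → Searchable B → ∀ n {P : Pred (Fin n → B) 0ℓ} →
  (∀ {f g} → f ≗ g → P f → P g) → Decidable P → Dec (∃ P)
search-Fin→ search zero resp P? with P? (λ ())
... | yes p  = yes (_ , p)
... | no  ¬p = no λ (f , p) → ¬p (resp (λ ()) p)
search-Fin→ search (suc n) resp P?
  with search (λ x → search-Fin→ search n (resp ∘ ∷-cong refl) (P? ∘ (x ∷_)))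
... | yes (x , f , p) = yes (x ∷ f , p)
... | no  ¬q          = no λ (f , p) → ¬q (f zero , f ∘ suc , resp (∷-cong refl (λ _ → refl)) p)

module _ {m n} (I : Instance m n) (X : Subset n) where
  open Instance I

  feasible? : (a : Allocation m n) → Dec (Feasible I X a)
  feasible? a =
    (all? λ i → all? λ j → ≡-dec-Maybe _≟_ (a i) (just j) →-dec (i ∈? X ×-dec T? (adj i j)))
    ×-dec all? (λ j → load a j ≤? cap j)

  feasible-≗ : ∀ {a b : Allocation m n} → a ≗ b → Feasible I X a → Feasible I X b
  feasible-≗ a≗b (itemsOk , loadsOk) =
      (λ i j bᵢ≡j → itemsOk i j (trans (a≗b i) bᵢ≡j))
    , (λ j → subst (_≤ cap j) (count-cong (λ i → cong (λ x → assignedTo x j) (a≗b i))) (loadsOk j))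

  Improvable : Allocation m n → Set
  Improvable a = ∃[ c ] Feasible I X c × value a < value c

  improvable? : (a : Allocation m n) → Dec (Improvable a)
  improvable? a = search-Fin→ (searchable-Maybe any?) n
    (λ c≗c′ (fc , va<vc) → feasible-≗ c≗c′ fc , subst (value a <_) (count-cong (cong isAssigned ∘ c≗c′)) va<vc)
    (λ c → feasible? c ×-dec (value a <? value c))

  budget-step : ∀ {k v v′} → n ≤ suc k + v → v < v′ → n ≤ k + v′
  budget-step {k} {v} {v′} n≤1+k+v v<v′ = ≤-trans n≤1+k+v (subst (_≤ k + v′) (+-suc k v) (+-monoʳ-≤ k v<v′))

  optimalAboveWithin : ∀ k {a : Allocation m n} → n ≤ k + value a → Feasible I X a →
    ∃[ a* ] Optimal I X a* × a ⊑ a*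
  optimalAboveWithin k {a} n≤k+va fa with improvable? a
  ... | no ¬improvable = a , (fa , λ b fb → ≮⇒≥ λ va<vb → ¬improvable (b , fb , va<vb)) , ⊑-refl
  ... | yes (c , fc , va<vc) with k
  ...   | zero  = contradiction (≤-trans (count≤n _) n≤k+va) (<⇒≱ va<vc)
  ...   | suc k′
    with a′ , fa′ , va<va′ , a⊑a′ ← augment fa fc va<vc
    with a* , opt , a′⊑a* ← optimalAboveWithin k′ (budget-step n≤k+va va<va′) fa′
    = a* , opt , ⊑-trans a⊑a′ a′⊑a*

  optimalAbove : ∀ {a : Allocation m n} → Feasible I X a → ∃[ a* ] Optimal I X a* × a ⊑ a*
  optimalAbove {a} = optimalAboveWithin n (m≤m+n n (value a))

restrict : ∀ {m n} → Subset n → Allocation m n → Allocation m n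
restrict S a i = if lookup S i then a i else nothing

module _ {m n} {I : Instance m n} where

  restrict-feasible : ∀ {X} S {a : Allocation m n} → Feasible I X a → Feasible I S (restrict S a)
  restrict-feasible S {a} (itemsOk , loadsOk) = itemsOk′ , loadsOk′
    where
    itemsOk′ : ∀ i j → restrict S a i ≡ just j → (i ∈ S) × T (Instance.adj I i j)
    itemsOk′ i j e with lookup S i in Sᵢ
    ... | true = lookup⇒[]= i S Sᵢ , proj₂ (itemsOk i j e)
    loadsOk′ : ∀ j → load (restrict S a) j ≤ Instance.cap I j
    loadsOk′ j = ≤-trans (count-mono assignedTo-restrict) (loadsOk j)
      where
      assignedTo-restrict : ∀ i → T (assignedTo (restrict S a i) j) → T (assignedTo (a i) j)
      assignedTo-restrict i with lookup S i
      ... | true  = id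
      ... | false = λ ()

  assigned⇒∈ : ∀ {X} {a : Allocation m n} → Feasible I X a → ∀ i → T (isAssigned (a i)) → i ∈ X
  assigned⇒∈ {a = a} (itemsOk , _) i aᵢ↓ with a i in aᵢ
  ... | just j = proj₁ (itemsOk i j aᵢ)

  ⊑-restrict : ∀ {S} {a b : Allocation m n} → Feasible I S b → b ⊑ a → b ⊑ restrict S a
  ⊑-restrict {S} fb b⊑a i bᵢ↓ with lookup S i in Sᵢ
  ... | true  = b⊑a i bᵢ↓
  ... | false with () ← trans (sym Sᵢ) ([]=⇒lookup (assigned⇒∈ fb i bᵢ↓))

  feasible-⊆ : ∀ {X Y} {a : Allocation m n} → X ⊆ Y → Feasible I X a → Feasible I Y a
  feasible-⊆ X⊆Y (itemsOk , loadsOk) = (λ i j aᵢ≡j → map₁ X⊆Y (itemsOk i j aᵢ≡j)) , loadsOk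

  empty-feasible : ∀ {X} → Feasible I X (λ _ → nothing)
  empty-feasible = (λ _ _ ()) , λ j → subst (_≤ Instance.cap I j) (sym (count-false n)) z≤n

value-restrict : ∀ {m n} S (a : Allocation m n) → value (restrict S a) ≡ contrib S a
value-restrict S a = count-cong isAssigned-restrict
  where
  isAssigned-restrict : ∀ i → isAssigned (restrict S a i) ≡ lookup S i ∧ isAssigned (a i)
  isAssigned-restrict i with lookup S i
  ... | true  = refl
  ... | false = refl

mainTheorem10 : ∀ {m n} (I : Instance m n) (S A : Subset n) →
    ((i : Fin n) → i ∈ S → i ∈ A → ⊥) →
    Σ (Allocation m n) λ a → Σ (Allocation m n) λ b →
      Optimal I (S ∪ A) a × Optimal I S b × contrib S a ≡ value b
mainTheorem10 I S A _
  with b , optB@(fb , bMaximal) , _ ← optimalAbove I S (empty-feasible {I = I})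
  with a , optA@(fa , _) , b⊑a ← optimalAbove I (S ∪ A) (feasible-⊆ (p⊆p∪q A) fb)
  = a , b , optA , optB , ≤-antisym contrib≤vb vb≤contrib
  where
  contrib≤vb : contrib S a ≤ value b
  contrib≤vb = subst (_≤ value b) (value-restrict S a) (bMaximal (restrict S a) (restrict-feasible S fa))
  vb≤contrib : value b ≤ contrib S a
  vb≤contrib = subst (value b ≤_) (value-restrict S a) (value-mono (⊑-restrict fb b⊑a))
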